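{- Let $q\ge 0$ and $t\ge 1$ be integers and $k\ge 1$. Then the order of the critical group of the $(q,t)$-wheel graph satisfies $$\big|K(W_k(q,t))\big| = -N_k(q,-t),$$ where $N_k(q,x)$ is the polynomial defined in the context.
   Context: The $(q,t)$-wheel graph $W_k(q,t)$ is the directed multigraph with a hub $v_0$ and rim vertices $v_1,\dots,v_k$ in clockwise order (rim indices taken modulo $k$), having $t$ edges from $v_0$ to $v_i$ and $t$ edges from $v_i$ to $v_0$ for each $i$, one edge from $v_i$ to $v_{i-1}$ and $q$ edges from $v_i$ to $v_{i+1}$ for each $i$. Its critical group (with bank vertex $v_0$) $K(W_k(q,t))$ is the group of critical configurations of the dollar game on this graph; it is isomorphic to $\mathbb{Z}^k/\overline{M}_k\mathbb{Z}^k$, where $\overline{M}_k$ is the reduced Laplacian: $\overline{M}_1=[t]$, $\overline{M}_2=\begin{pmatrix}1+q+t&-1-q\\-1-q&1+q+t\end{pmatrix}$, and for $k\ge3$, $\overline{M}_k$ is the $k\times k$ matrix with diagonal entries $1+q+t$, entries $(i,i+1 \bmod k)$ equal to $-q$, entries $(i,i-1\bmod k)$ equal to $-1$, and all other entries $0$. For an elliptic curve $E$ over $\mathbb{F}_q$ with $N_1=\#E(\mathbb{F}_q)$, the numbers $N_k=\#E(\mathbb{F}_{q^k})$ are given by a bivariate integer polynomial $N_k(q,N_1)$, determined by $\exp\big(\sum_{k\ge1} N_k T^k/k\big)=\frac{1-(1+q-N_1)T+qT^2}{(1-T)(1-qT)}$; equivalently $N_k(q,x)=1+q^k-\alpha^k-\beta^k$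 where $\alpha+\beta=1+q-x$ and $\alpha\beta=q$. -}

module Defs where

open import Data.Nat as ℕ using (ℕ; zero; suc; _%_)
open import Data.Integer using (ℤ; +_; -_; _+_; _-_; _*_)
open import Data.Fin using (Fin; toℕ) renaming (zero to fz; suc to fs)
open import Data.Bool using (if_then_else_)
open import Data.Product using (Σ; ∃; _×_)
open import Relation.Binary.PropositionalEquality using (_≡_)
open import Relation.Nullary using (¬_)
open import Relation.Nullary.Decidable using (⌊_⌋)

Vecℤ : ℕ → Set
Vecℤ k = Fin k → ℤ

Matℤ : ℕ → Set
Matℤ k = Fin k → Fin k → ℤ

sumFin : ∀ {k} → (Fin k → ℤ) → ℤ
sumFin {zero}  f = + 0
sumFin {suc k} f = f fz + sumFin (λ j → f (fs j))

_·_ : ∀ {k} → Matℤ k → Vecℤ k → Vecℤ k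
(M · z) i = sumFin (λ j → M i j * z j)

_≈[_]_ : ∀ {k} → Vecℤ k → Matℤ k → Vecℤ k → Set
_≈[_]_ {k} x M y = Σ (Vecℤ k) λ z → ∀ i → x i - y i ≡ (M · z) i

-- The group ℤ^k / M ℤ^k has exactly n elements: there are n representatives
-- that are pairwise distinct modulo M ℤ^k and every vector is congruent to one of them.
QuotientHasOrder : ∀ k → Matℤ k → ℕ → Set
QuotientHasOrder k M n =
  Σ (Fin n → Vecℤ k) λ rep →
    (∀ a b → rep a ≈[ M ] rep b → a ≡ b) ×
    (∀ (x : Vecℤ k) → ∃ λ a → x ≈[ M ] rep a)

-- Reduced Laplacian M̄_k of the (q,t)-wheel graph W_k(q,t), bank vertex v₀,
-- rim vertices v_1..v_k indexed by Fin k (index i ↦ v_{i+1}).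
reducedLaplacian : (k q t : ℕ) → Matℤ k
reducedLaplacian zero q t ()
reducedLaplacian (suc zero) q t i j = + t
reducedLaplacian (suc (suc zero)) q t fz fz = + (1 ℕ.+ q ℕ.+ t)
reducedLaplacian (suc (suc zero)) q t fz (fs fz) = - + (1 ℕ.+ q)
reducedLaplacian (suc (suc zero)) q t (fs fz) fz = - + (1 ℕ.+ q)
reducedLaplacian (suc (suc zero)) q t (fs fz) (fs fz) = + (1 ℕ.+ q ℕ.+ t)
reducedLaplacian k@(suc (suc (suc _))) q t i j =
  if ⌊ toℕ i ℕ.≟ toℕ j ⌋ then + (1 ℕ.+ q ℕ.+ t)
  else if ⌊ toℕ j ℕ.≟ (suc (toℕ i)) % k ⌋ then - + q
  else if ⌊ toℕ i ℕ.≟ (suc (toℕ j)) % k ⌋ then - + 1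
  else + 0

-- Power sums s_k = α^k + β^k where α+β = 1+q-x, αβ = q (Newton recurrence).
powerSum : ℕ → ℤ → ℤ → ℤ
powerSum zero q x = + 2
powerSum (suc zero) q x = + 1 + q - x
powerSum (suc (suc k)) q x =
  (+ 1 + q - x) * powerSum (suc k) q x - q * powerSum k q x

_^ℤ_ : ℤ → ℕ → ℤ
a ^ℤ zero = + 1
a ^ℤ suc n = a * (a ^ℤ n)

Npoly : ℕ → ℤ → ℤ → ℤ
Npoly k q x = + 1 + q ^ℤ k - powerSum k q x

-- Modulo the lattice spanned by the columns of the reduced Laplacian M, column j is the relation
-- e_{j+1} ≡ s e_j − q e_{j−1} with s = 1 + q + t (indices mod k).  Hence every basis vector e_n is
-- congruent to U_n e₀ + W_n e₁, where U and W solve u_{n+2} = s u_{n+1} − q u_n, and ℤᵏ/Mℤᵏ is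
-- isomorphic to ℤ²/Bℤ², the two columns of B coming from the two relations that wrap around the
-- rim.  A 2×2 integer matrix of positive determinant D has a quotient of order D (column operations
-- with Bézout coefficients make it lower triangular).  Cassini's identity and the Lucas relation
-- P_{n+1} = W_{n+2} − q W_n for the power sums P_n = αⁿ + βⁿ evaluate det B as P_k − q^k − 1, which
-- is −N_k(q, −t); it is positive because this sequence is increasing in k.
module Submission where

open import Defs
open import Data.Bool using (if_then_else_)
open import Data.Empty using (⊥-elim)
open import Data.Fin using (Fin; toℕ; fromℕ<) renaming (zero to fz; suc to fs)
import Data.Fin.Properties as FP
open import Data.Integer as ℤ using (ℤ; +_; -[1+_]; -_; _+_; _-_; _*_; ∣_∣; 0ℤ; 1ℤ; _⊖_)
import Data.Integer.DivMod as ℤD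
open import Data.Integer.Divisibility.Signed using (∣ᵤ⇒∣; _∣_; quotient)
import Data.Integer.GCD as ℤG
import Data.Integer.Properties as ℤP
open import Data.Integer.Tactic.RingSolver using (solve-∀)
open import Data.Nat as ℕ using (ℕ; zero; suc; NonZero; _%_; _<_; _≤_; z≤n; s≤s)
import Data.Nat.DivMod as ℕD
import Data.Nat.GCD as ℕG
import Data.Nat.Properties as ℕP
open import Data.Product using (Σ; ∃; ∃₂; _×_; _,_; proj₁; proj₂)
open import Data.Sum using (_⊎_; inj₁; inj₂)
open import Data.Vec.Functional using (_∷_; [])
open import Function using (_∘_; _↔_; Inverse; it)
open import Relation.Binary.Bundles using (Setoid)
open import Relation.Binary.PropositionalEquality
import Relation.Binary.Reasoning.Setoid as SetoidReasoning
open import Relation.Nullary using (yes; no; ¬_)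
open import Relation.Nullary.Decidable using (⌊_⌋)
open import Algebra.Properties.CommutativeSemigroup ℤP.*-commutativeSemigroup using (x∙yz≈y∙xz)
open import Algebra.Properties.Ring ℤP.+-*-ring using (x[y-z]≈xy-xz; -1*x≈-x)
open import Algebra.Properties.Semiring.Sum ℤP.+-*-semiring
  using (sum; sum-cong-≗; ∑-comm; *-distribˡ-sum; sum-replicate-zero)

δ : ℕ → ℕ → ℤ
δ zero    zero    = 1ℤ
δ zero    (suc n) = 0ℤ
δ (suc m) zero    = 0ℤ
δ (suc m) (suc n) = δ m n

δ-≡ : ∀ {m n} → m ≡ n → δ m n ≡ 1ℤ
δ-≡ {zero}  refl = refl
δ-≡ {suc m} refl = δ-≡ {m} refl

δ-≢ : ∀ {m n} → ¬ m ≡ n → δ m n ≡ 0ℤ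
δ-≢ {zero}  {zero}  m≢n = ⊥-elim (m≢n refl)
δ-≢ {zero}  {suc n} m≢n = refl
δ-≢ {suc m} {zero}  m≢n = refl
δ-≢ {suc m} {suc n} m≢n = δ-≢ (m≢n ∘ cong suc)

δ-cong : ∀ {m n m′ n′} → (m ≡ n → m′ ≡ n′) → (m′ ≡ n′ → m ≡ n) → δ m n ≡ δ m′ n′
δ-cong {m} {n} to from with m ℕ.≟ n
... | yes m≡n = trans (δ-≡ m≡n) (sym (δ-≡ (to m≡n)))
... | no m≢n  = trans (δ-≢ m≢n) (sym (δ-≢ (m≢n ∘ from)))

δ-comm : ∀ m n → δ m n ≡ δ n m
δ-comm m n = δ-cong {m} {n} {n} {m} sym sym

-- The n-th standard basis vector of ℤᵏ; it is zero when n ≥ k.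
basis : ∀ {k} → ℕ → Vecℤ k
basis n i = δ (toℕ i) n

Mat : ℕ → ℕ → Set
Mat m k = Fin m → Fin k → ℤ

identity : ∀ {k} → Matℤ k
identity i j = δ (toℕ i) (toℕ j)

col : ∀ {m k} → Mat m k → Fin k → Vecℤ m
col A j i = A i j

infixr 25 _⊙_
infixr 22 _*ᵥ_
infixl 21 _-ᵥ_

_⊙_ : ∀ {m k} → Mat m k → Vecℤ k → Vecℤ m
(A ⊙ x) i = sum λ j → A i j * x j

_*ᵥ_ : ∀ {k} → ℤ → Vecℤ k → Vecℤ k
(a *ᵥ x) i = a * x i

_-ᵥ_ : ∀ {k} → Vecℤ k → Vecℤ k → Vecℤ k
(x -ᵥ y) i = x i - y i

lincomb : ∀ {n k} → (Fin n → ℤ) → (Fin n → Vecℤ k) → Vecℤ k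
lincomb c X i = sum λ j → c j * X j i

sumFin≡sum : ∀ {k} (f : Fin k → ℤ) → sumFin f ≡ sum f
sumFin≡sum {zero}  f = refl
sumFin≡sum {suc k} f = cong (λ s → f fz + s) (sumFin≡sum (f ∘ fs))

·≗⊙ : ∀ {k} (M : Matℤ k) z → M · z ≗ M ⊙ z
·≗⊙ M z i = sumFin≡sum λ j → M i j * z j

∑-zero : ∀ {k} (f : Fin k → ℤ) → (∀ i → f i ≡ 0ℤ) → sum f ≡ 0ℤ
∑-zero {k} f f≗0 = trans (sum-cong-≗ f≗0) (sum-replicate-zero k)

∑-distrib-sub : ∀ {k} (f g : Fin k → ℤ) → sum (λ i → f i - g i) ≡ sum f - sum g
∑-distrib-sub {zero}  f g = refl
∑-distrib-sub {suc k} f g =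
  trans (cong (λ s → f fz - g fz + s) (∑-distrib-sub (f ∘ fs) (g ∘ fs)))
        (interchange (f fz) (g fz) (sum (f ∘ fs)) (sum (g ∘ fs)))
  where
  interchange : ∀ a b c d → a - b + (c - d) ≡ a + c - (b + d)
  interchange = solve-∀

∑-δ : ∀ {k} (f : Fin k → ℤ) (j : Fin k) → sum (λ i → δ (toℕ i) (toℕ j) * f i) ≡ f j
∑-δ f fz     = trans (cong₂ _+_ (ℤP.*-identityˡ (f fz)) (∑-zero (λ i → δ (toℕ (fs i)) 0 * f (fs i)) λ _ → refl))
                     (ℤP.+-identityʳ (f fz))
∑-δ f (fs j) = trans (ℤP.+-identityˡ (sum λ i → δ (toℕ i) (toℕ j) * f (fs i))) (∑-δ (f ∘ fs) j)

⊙-cong : ∀ {m k} (A : Mat m k) {x y : Vecℤ k} → x ≗ y → A ⊙ x ≗ A ⊙ y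
⊙-cong A x≗y i = sum-cong-≗ λ j → cong (A i j *_) (x≗y j)

⊙-basis : ∀ {m k} (A : Mat m k) (j : Fin k) → A ⊙ basis (toℕ j) ≗ col A j
⊙-basis A j i = trans (sum-cong-≗ λ l → ℤP.*-comm (A i l) _) (∑-δ (A i) j)

⊙-basis′ : ∀ {m k} (A : Mat m k) {n} (n<k : n < k) → A ⊙ basis n ≗ col A (fromℕ< n<k)
⊙-basis′ A n<k = subst (λ n → A ⊙ basis n ≗ col A (fromℕ< n<k)) (FP.toℕ-fromℕ< n<k) (⊙-basis A (fromℕ< n<k))

⊙-col : ∀ {m k} (A : Mat m k) (x : Vecℤ k) → A ⊙ x ≗ lincomb x (col A)
⊙-col A x i = sum-cong-≗ λ j → ℤP.*-comm (A i j) (x j)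

⊙-*ᵥ : ∀ {m k} (A : Mat m k) a (x : Vecℤ k) → A ⊙ (a *ᵥ x) ≗ a *ᵥ A ⊙ x
⊙-*ᵥ A a x i = trans (sum-cong-≗ λ j → x∙yz≈y∙xz (A i j) a (x j)) (sym (*-distribˡ-sum a λ j → A i j * x j))

⊙--ᵥ : ∀ {m k} (A : Mat m k) (x y : Vecℤ k) → A ⊙ (x -ᵥ y) ≗ A ⊙ x -ᵥ A ⊙ y
⊙--ᵥ A x y i = trans (sum-cong-≗ λ j → x[y-z]≈xy-xz (A i j) (x j) (y j))
                     (∑-distrib-sub (λ j → A i j * x j) (λ j → A i j * y j))

⊙-lin₂ : ∀ {m k} (A : Mat m k) a b (x y : Vecℤ k) → A ⊙ (a *ᵥ x -ᵥ b *ᵥ y) ≗ a *ᵥ A ⊙ x -ᵥ b *ᵥ A ⊙ y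
⊙-lin₂ A a b x y i = trans (⊙--ᵥ A (a *ᵥ x) (b *ᵥ y) i) (cong₂ _-_ (⊙-*ᵥ A a x i) (⊙-*ᵥ A b y i))

⊙-lincomb : ∀ {m k n} (A : Mat m k) (c : Fin n → ℤ) (X : Fin n → Vecℤ k) →
            A ⊙ lincomb c X ≗ lincomb c (λ j → A ⊙ X j)
⊙-lincomb A c X i = begin
  sum (λ l → A i l * sum (λ j → c j * X j l))
    ≡⟨ sum-cong-≗ (λ l → *-distribˡ-sum (A i l) λ j → c j * X j l) ⟩
  sum (λ l → sum (λ j → A i l * (c j * X j l)))
    ≡⟨ ∑-comm (λ l j → A i l * (c j * X j l)) ⟩
  sum (λ j → sum (λ l → A i l * (c j * X j l)))
    ≡⟨ sum-cong-≗ (λ j → sum-cong-≗ λ l → x∙yz≈y∙xz (A i l) (c j) (X j l)) ⟩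
  sum (λ j → sum (λ l → c j * (A i l * X j l)))
    ≡⟨ sum-cong-≗ (λ j → *-distribˡ-sum (c j) λ l → A i l * X j l) ⟨
  sum (λ j → c j * sum (λ l → A i l * X j l))    ∎
  where open ≡-Reasoning

lincomb-basis : ∀ {k} (x : Vecℤ k) → lincomb x (basis ∘ toℕ) ≗ x
lincomb-basis x i =
  trans (sum-cong-≗ λ j → trans (ℤP.*-comm (x j) _) (cong (_* x j) (δ-comm (toℕ i) (toℕ j)))) (∑-δ x i)

identity-⊙ : ∀ {k} (x : Vecℤ k) → identity ⊙ x ≗ x
identity-⊙ x i = trans (⊙-col identity x i) (lincomb-basis x i)

infix 4 _∈ℒ_

_∈ℒ_ : ∀ {k} → Vecℤ k → Matℤ k → Set
_∈ℒ_ {k} x M = Σ (Vecℤ k) λ z → x ≗ M ⊙ z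

col∈ℒ : ∀ {k} (M : Matℤ k) j → col M j ∈ℒ M
col∈ℒ M j = basis (toℕ j) , λ i → sym (⊙-basis M j i)

-- The vectors related by ≈[ M ] are often passed explicitly: the relation unfolds to pointwise
-- integer equations, from which Agda cannot infer them.
module _ {k} {M : Matℤ k} where

  ∈ℒ-resp : ∀ {x y} → x ≗ y → x ∈ℒ M → y ∈ℒ M
  ∈ℒ-resp x≗y (z , x≗Mz) = z , λ i → trans (sym (x≗y i)) (x≗Mz i)

  0∈ℒ : (λ _ → 0ℤ) ∈ℒ M
  0∈ℒ = (λ _ → 0ℤ) , λ i → sym (∑-zero (λ j → M i j * 0ℤ) λ j → ℤP.*-zeroʳ (M i j))

  ∈ℒ-lincomb : ∀ {n} (c : Fin n → ℤ) (X : Fin n → Vecℤ k) → (∀ j → X j ∈ℒ M) → lincomb c X ∈ℒ M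
  ∈ℒ-lincomb c X X∈ℒ = lincomb c Z , λ i →
      trans (sum-cong-≗ λ j → cong (c j *_) (proj₂ (X∈ℒ j) i)) (sym (⊙-lincomb M c Z i))
    where
    Z = proj₁ ∘ X∈ℒ

  ∈ℒ-span : ∀ {x} → x ∈ℒ M → Σ (Vecℤ k) λ z → x ≗ lincomb z (col M)
  ∈ℒ-span (z , x≗Mz) = z , λ i → trans (x≗Mz i) (⊙-col M z i)

  ∈ℒ⇒≈ : ∀ {x y} → x -ᵥ y ∈ℒ M → x ≈[ M ] y
  ∈ℒ⇒≈ (z , eq) = z , λ i → trans (eq i) (sym (·≗⊙ M z i))

  ≈⇒∈ℒ : ∀ {x y} → x ≈[ M ] y → x -ᵥ y ∈ℒ M
  ≈⇒∈ℒ (z , eq) = z , λ i → trans (eq i) (·≗⊙ M z i)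

  ≗⇒≈ : ∀ {x y} → x ≗ y → x ≈[ M ] y
  ≗⇒≈ {x} {y} x≗y = ∈ℒ⇒≈ {x} {y} (∈ℒ-resp x-y≗0 0∈ℒ)
    where
    x-y≗0 : (λ _ → 0ℤ) ≗ x -ᵥ y
    x-y≗0 i = sym (trans (cong (λ v → x i - v) (sym (x≗y i))) (ℤP.+-inverseʳ (x i)))

  ≈-refl : ∀ {x} → x ≈[ M ] x
  ≈-refl {x} = ≗⇒≈ {x} {x} λ _ → refl

  ≈-sym : ∀ {x y} → x ≈[ M ] y → y ≈[ M ] x
  ≈-sym {x} {y} x≈y = ∈ℒ⇒≈ {y} {x} (∈ℒ-resp (λ i → flip (x i) (y i))
    (∈ℒ-lincomb (λ _ → - 1ℤ) (λ (_ : Fin 1) → x -ᵥ y) (λ _ → ≈⇒∈ℒ {x} {y} x≈y)))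
    where
    flip : ∀ a b → - 1ℤ * (a - b) + 0ℤ ≡ b - a
    flip = solve-∀

  ≈-trans : ∀ {x y w} → x ≈[ M ] y → y ≈[ M ] w → x ≈[ M ] w
  ≈-trans {x} {y} {w} x≈y y≈w = ∈ℒ⇒≈ {x} {w} (∈ℒ-resp (λ i → telescope (x i) (y i) (w i))
    (∈ℒ-lincomb (λ _ → 1ℤ) (x -ᵥ y ∷ y -ᵥ w ∷ [])
      λ { fz → ≈⇒∈ℒ {x} {y} x≈y ; (fs fz) → ≈⇒∈ℒ {y} {w} y≈w }))
    where
    telescope : ∀ a b c → 1ℤ * (a - b) + (1ℤ * (b - c) + 0ℤ) ≡ a - c
    telescope = solve-∀

  ≈-lincomb : ∀ {n} (c : Fin n → ℤ) {X Y : Fin n → Vecℤ k} →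
              (∀ j → X j ≈[ M ] Y j) → lincomb c X ≈[ M ] lincomb c Y
  ≈-lincomb c {X} {Y} X≈Y = ∈ℒ⇒≈ {lincomb c X} {lincomb c Y} (∈ℒ-resp lincomb-sub
    (∈ℒ-lincomb c (λ j → X j -ᵥ Y j) (λ j → ≈⇒∈ℒ {X j} {Y j} (X≈Y j))))
    where
    lincomb-sub : lincomb c (λ j → X j -ᵥ Y j) ≗ lincomb c X -ᵥ lincomb c Y
    lincomb-sub i = trans (sum-cong-≗ λ j → x[y-z]≈xy-xz (c j) (X j i) (Y j i))
                          (∑-distrib-sub (λ j → c j * X j i) (λ j → c j * Y j i))

  ∈ℒ-≈ : ∀ {x y} → x ∈ℒ M → x ≈[ M ] y → y ∈ℒ M
  ∈ℒ-≈ {x} {y} x∈ℒ x≈y = ∈ℒ-resp (λ i → cancel (x i) (y i))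
    (∈ℒ-lincomb (1ℤ ∷ - 1ℤ ∷ []) (x ∷ x -ᵥ y ∷ []) λ { fz → x∈ℒ ; (fs fz) → ≈⇒∈ℒ {x} {y} x≈y })
    where
    cancel : ∀ u v → 1ℤ * u + (- 1ℤ * (u - v) + 0ℤ) ≡ v
    cancel = solve-∀

quotientSetoid : ∀ {k} → Matℤ k → Setoid _ _
quotientSetoid {k} M = record
  { Carrier       = Vecℤ k
  ; _≈_           = λ x y → x ≈[ M ] y
  ; isEquivalence = record
    { refl  = λ {x} → ≈-refl {M = M} {x}
    ; sym   = λ {x} {y} → ≈-sym {M = M} {x} {y}
    ; trans = λ {x} {y} {w} → ≈-trans {M = M} {x} {y} {w}
    }
  }

module ≈-Reasoning {k} (M : Matℤ k) = SetoidReasoning (quotientSetoid M)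

≈-lin₂ : ∀ {k} {M : Matℤ k} a b {x x′ y y′ : Vecℤ k} → x ≈[ M ] x′ → y ≈[ M ] y′ →
         a *ᵥ x -ᵥ b *ᵥ y ≈[ M ] a *ᵥ x′ -ᵥ b *ᵥ y′
≈-lin₂ {M = M} a b {x} {x′} {y} {y′} x≈x′ y≈y′ = begin
  a *ᵥ x -ᵥ b *ᵥ y
    ≈⟨ ≗⇒≈ {M = M} (λ i → as-lincomb a b (x i) (y i)) ⟩
  lincomb (a ∷ - b ∷ []) (x ∷ y ∷ [])
    ≈⟨ ≈-lincomb {M = M} (a ∷ - b ∷ []) {x ∷ y ∷ []} {x′ ∷ y′ ∷ []} (λ { fz → x≈x′ ; (fs fz) → y≈y′ }) ⟩
  lincomb (a ∷ - b ∷ []) (x′ ∷ y′ ∷ [])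
    ≈⟨ ≗⇒≈ {M = M} (λ i → sym (as-lincomb a b (x′ i) (y′ i))) ⟩
  a *ᵥ x′ -ᵥ b *ᵥ y′
    ∎
  where
  open ≈-Reasoning M
  as-lincomb : ∀ a b u v → a * u - b * v ≡ a * u + (- b * v + 0ℤ)
  as-lincomb = solve-∀

QuotientHasOrder-↔ : ∀ {k n} {M : Matℤ k} {A : Set} → Fin n ↔ A → (rep : A → Vecℤ k) →
  (∀ a b → rep a ≈[ M ] rep b → a ≡ b) → (∀ x → ∃ λ a → x ≈[ M ] rep a) →
  QuotientHasOrder k M n
QuotientHasOrder-↔ {M = M} n↔A rep rep-inj rep-surj = rep ∘ to , rep∘to-inj , rep∘to-surj
  where
  open Inverse n↔A
  rep∘to-inj : ∀ a b → rep (to a) ≈[ M ] rep (to b) → a ≡ b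
  rep∘to-inj a b ra≈rb = begin
    a             ≡⟨ strictlyInverseʳ a ⟨
    from (to a)   ≡⟨ cong from (rep-inj (to a) (to b) ra≈rb) ⟩
    from (to b)   ≡⟨ strictlyInverseʳ b ⟩
    b             ∎
    where open ≡-Reasoning
  rep∘to-surj : ∀ x → ∃ λ a → x ≈[ M ] rep (to a)
  rep∘to-surj x with rep-surj x
  ... | a , x≈ra = from a , subst (λ b → x ≈[ M ] rep b) (sym (strictlyInverseˡ a)) x≈ra

QuotientHasOrder-transfer : ∀ {k m n} {M : Matℤ k} {B : Matℤ m} (f : Vecℤ k → Vecℤ m) (g : Vecℤ m → Vecℤ k) →
  (∀ {x y} → x ≈[ M ] y → f x ≈[ B ] f y) → (∀ {x y} → x ≈[ B ] y → g x ≈[ M ] g y) →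
  (∀ x → x ≈[ M ] g (f x)) → (∀ y → y ≈[ B ] f (g y)) →
  QuotientHasOrder m B n → QuotientHasOrder k M n
QuotientHasOrder-transfer {M = M} {B} f g f-resp g-resp gf≈id fg≈id (rep , rep-inj , rep-surj) =
  g ∘ rep , g∘rep-inj , g∘rep-surj
  where
  g∘rep-inj : ∀ a b → g (rep a) ≈[ M ] g (rep b) → a ≡ b
  g∘rep-inj a b ga≈gb = rep-inj a b (begin
    rep a           ≈⟨ fg≈id (rep a) ⟩
    f (g (rep a))   ≈⟨ f-resp ga≈gb ⟩
    f (g (rep b))   ≈⟨ fg≈id (rep b) ⟨
    rep b           ∎)
    where open ≈-Reasoning B
  g∘rep-surj : ∀ x → ∃ λ a → x ≈[ M ] g (rep a)
  g∘rep-surj x with rep-surj (f x)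
  ... | a , fx≈ra = a , (begin
    x               ≈⟨ gf≈id x ⟩
    g (f x)         ≈⟨ g-resp fx≈ra ⟩
    g (rep a)       ∎)
    where open ≈-Reasoning M

⊙-∈ℒ : ∀ {k m} {M : Matℤ k} {B : Matℤ m} (A : Mat m k) →
       (∀ j → A ⊙ col M j ∈ℒ B) → ∀ {x} → x ∈ℒ M → A ⊙ x ∈ℒ B
⊙-∈ℒ {M = M} {B} A A∈ℒ {x} x∈ℒ with ∈ℒ-span x∈ℒ
... | z , x≗Mz = ∈ℒ-resp {M = B} Ax≗ (∈ℒ-lincomb {M = B} z (λ j → A ⊙ col M j) A∈ℒ)
  where
  Ax≗ : lincomb z (λ j → A ⊙ col M j) ≗ A ⊙ x
  Ax≗ i = sym (trans (⊙-cong A x≗Mz i) (⊙-lincomb A z (col M) i))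

⊙-resp-≈ : ∀ {k m} {M : Matℤ k} {B : Matℤ m} (A : Mat m k) →
           (∀ j → A ⊙ col M j ∈ℒ B) → ∀ {x y} → x ≈[ M ] y → A ⊙ x ≈[ B ] A ⊙ y
⊙-resp-≈ {M = M} {B} A A∈ℒ {x} {y} x≈y = ∈ℒ⇒≈ {M = B} {A ⊙ x} {A ⊙ y}
  (∈ℒ-resp {M = B} (⊙--ᵥ A x y) (⊙-∈ℒ {M = M} {B} A A∈ℒ (≈⇒∈ℒ {M = M} {x} {y} x≈y)))

basis-≈⇒≈ : ∀ {k m} {M : Matℤ k} (F : Mat m k) (G : Mat k m) →
            (∀ j → basis (toℕ j) ≈[ M ] G ⊙ col F j) → ∀ x → x ≈[ M ] G ⊙ F ⊙ x
basis-≈⇒≈ {M = M} F G basis≈ x = begin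
  x                               ≈⟨ ≗⇒≈ {M = M} (λ i → sym (lincomb-basis x i)) ⟩
  lincomb x (basis ∘ toℕ)         ≈⟨ ≈-lincomb {M = M} x basis≈ ⟩
  lincomb x (λ j → G ⊙ col F j)   ≈⟨ ≗⇒≈ {M = M} (λ i → sym (⊙-lincomb G x (col F) i)) ⟩
  G ⊙ lincomb x (col F)           ≈⟨ ≗⇒≈ {M = M} (⊙-cong G λ i → sym (⊙-col F x i)) ⟩
  G ⊙ F ⊙ x                       ∎
  where open ≈-Reasoning M

QuotientHasOrder-retract : ∀ {k m n} {M : Matℤ k} {B : Matℤ m} (F : Mat m k) (G : Mat k m) →
  (∀ j → F ⊙ col M j ∈ℒ B) → (∀ d → G ⊙ col B d ∈ℒ M) →
  (∀ j → basis (toℕ j) ≈[ M ] G ⊙ col F j) → (∀ d → basis (toℕ d) ≈[ B ] F ⊙ col G d) →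
  QuotientHasOrder m B n → QuotientHasOrder k M n
QuotientHasOrder-retract {M = M} {B} F G F∈ℒ G∈ℒ G⊙F≈id F⊙G≈id =
  QuotientHasOrder-transfer {M = M} {B} (F ⊙_) (G ⊙_)
    (⊙-resp-≈ {M = M} {B} F F∈ℒ) (⊙-resp-≈ {M = B} {M} G G∈ℒ)
    (basis-≈⇒≈ {M = M} F G G⊙F≈id) (basis-≈⇒≈ {M = B} G F F⊙G≈id)

QuotientHasOrder-sameLattice : ∀ {k n} {M B : Matℤ k} →
  (∀ j → col M j ∈ℒ B) → (∀ j → col B j ∈ℒ M) → QuotientHasOrder k B n → QuotientHasOrder k M n
QuotientHasOrder-sameLattice {M = M} {B} M⊆B B⊆M =
  QuotientHasOrder-retract {M = M} {B} identity identity
    (λ j → ∈ℒ-resp {M = B} (λ i → sym (identity-⊙ (col M j) i)) (M⊆B j))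
    (λ j → ∈ℒ-resp {M = M} (λ i → sym (identity-⊙ (col B j) i)) (B⊆M j))
    (λ j → ≗⇒≈ {M = M} λ i → sym (identity-⊙ (basis (toℕ j)) i))
    (λ j → ≗⇒≈ {M = B} λ i → sym (identity-⊙ (basis (toℕ j)) i))

divMod : ∀ g .{{_ : NonZero g}} (x : ℤ) → Σ (Fin g) λ r → ∃ λ m → x ≡ + toℕ r + m * + g
divMod g x = fromℕ< (ℤD.n%ℕd<d x g) , x ℤD./ℕ g ,
  trans (ℤD.a≡a%ℕn+[a/ℕn]*n x g) (cong (λ r → + r + (x ℤD./ℕ g) * + g) (sym (FP.toℕ-fromℕ< _)))

residue-difference≡g*z⇒z≡0 : ∀ {g i j} → i < g → j < g → ∀ z → + i - + j ≡ + g * z → z ≡ 0ℤ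
residue-difference≡g*z⇒z≡0 {g} {i} {j} i<g j<g z i-j≡gz =
  ℤP.∣i∣≡0⇒i≡0 (ℕP.n<1⇒n≡0 (ℕP.*-cancelˡ-< g ∣ z ∣ 1 (begin-strict
    g ℕ.* ∣ z ∣     ≡⟨ ℤP.abs-* (+ g) z ⟨
    ∣ + g * z ∣     ≡⟨ cong ∣_∣ i-j≡gz ⟨
    ∣ + i - + j ∣   ≡⟨ cong ∣_∣ (ℤP.m-n≡m⊖n i j) ⟩
    ∣ i ⊖ j ∣       ≤⟨ ℤP.∣m⊝n∣≤m⊔n i j ⟩
    i ℕ.⊔ j         <⟨ ℕP.⊔-lub i<g j<g ⟩
    g               ≡⟨ ℕP.*-identityʳ g ⟨
    g ℕ.* 1         ∎)))
  where open ℕP.≤-Reasoning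

residue-unique : ∀ {g} (r s : Fin g) z → + toℕ r - + toℕ s ≡ + g * z → r ≡ s
residue-unique {g} r s z r-s≡gz = FP.toℕ-injective (ℤP.+-injective (ℤP.i-j≡0⇒i≡j _ _ (begin
  + toℕ r - + toℕ s   ≡⟨ r-s≡gz ⟩
  + g * z             ≡⟨ cong (+ g *_) (residue-difference≡g*z⇒z≡0 (FP.toℕ<n r) (FP.toℕ<n s) z r-s≡gz) ⟩
  + g * 0ℤ            ≡⟨ ℤP.*-zeroʳ (+ g) ⟩
  0ℤ                  ∎)))
  where open ≡-Reasoning

QuotientHasOrder-1×1 : ∀ g .{{_ : NonZero g}} → QuotientHasOrder 1 (λ _ _ → + g) g
QuotientHasOrder-1×1 g = rep , rep-inj , rep-surj
  where
  rep : Fin g → Vecℤ 1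
  rep r _ = + toℕ r
  rep-inj : ∀ r s → rep r ≈[ (λ _ _ → + g) ] rep s → r ≡ s
  rep-inj r s (z , eq) = residue-unique r s (z fz) (trans (eq fz) (ℤP.+-identityʳ (+ g * z fz)))
  rep-surj : ∀ x → ∃ λ r → x ≈[ (λ _ _ → + g) ] rep r
  rep-surj x with divMod g (x fz)
  ... | r , m , x≡r+mg =
    r , (λ _ → m) , λ { fz → trans (cong (λ v → v - + toℕ r) x≡r+mg) (cancel (+ toℕ r) m (+ g)) }
    where
    cancel : ∀ r m g → r + m * g - r ≡ g * m + 0ℤ
    cancel = solve-∀

lowerTriangular : ℕ → ℤ → ℕ → Matℤ 2
lowerTriangular g h e = (+ g ∷ 0ℤ ∷ []) ∷ (h ∷ + e ∷ []) ∷ []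

QuotientHasOrder-lowerTriangular : ∀ g h e .{{_ : NonZero g}} .{{_ : NonZero e}} →
  QuotientHasOrder 2 (lowerTriangular g h e) (g ℕ.* e)
QuotientHasOrder-lowerTriangular g h e = QuotientHasOrder-↔ {M = L} FP.*↔× rep rep-inj rep-surj
  where
  L : Matℤ 2
  L = lowerTriangular g h e

  rep : Fin g × Fin e → Vecℤ 2
  rep (r , s) = + toℕ r ∷ + toℕ s ∷ []

  rep-inj : ∀ a b → rep a ≈[ L ] rep b → a ≡ b
  rep-inj (r , s) (r′ , s′) (z , eq) =
    cong₂ _,_ (residue-unique r r′ (z fz) row₀) (residue-unique s s′ (z (fs fz)) row₁)
    where
    open ≡-Reasoning
    row₀ : + toℕ r - + toℕ r′ ≡ + g * z fz
    row₀ = trans (eq fz) (ℤP.+-identityʳ (+ g * z fz))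
    z₀≡0 : z fz ≡ 0ℤ
    z₀≡0 = residue-difference≡g*z⇒z≡0 (FP.toℕ<n r) (FP.toℕ<n r′) (z fz) row₀
    row₁ : + toℕ s - + toℕ s′ ≡ + e * z (fs fz)
    row₁ = begin
      + toℕ s - + toℕ s′                     ≡⟨ eq (fs fz) ⟩
      h * z fz + (+ e * z (fs fz) + 0ℤ)      ≡⟨ cong (λ w → h * w + (+ e * z (fs fz) + 0ℤ)) z₀≡0 ⟩
      h * 0ℤ + (+ e * z (fs fz) + 0ℤ)        ≡⟨ drop-zeros h (+ e * z (fs fz)) ⟩
      + e * z (fs fz)                        ∎
      where
      drop-zeros : ∀ h u → h * 0ℤ + (u + 0ℤ) ≡ u
      drop-zeros = solve-∀

  rep-surj : ∀ x → ∃ λ a → x ≈[ L ] rep a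
  rep-surj x with divMod g (x fz)
  ... | r , m , x₀≡ with divMod e (x (fs fz) - m * h)
  ... | s , m′ , x₁≡ = (r , s) , (m ∷ m′ ∷ []) , λ { fz → row₀ ; (fs fz) → row₁ }
    where
    open ≡-Reasoning
    row₀ : x fz - + toℕ r ≡ + g * m + (0ℤ * m′ + 0ℤ)
    row₀ = trans (cong (λ v → v - + toℕ r) x₀≡) (cancel (+ toℕ r) m (+ g) m′)
      where
      cancel : ∀ r m g m′ → r + m * g - r ≡ g * m + (0ℤ * m′ + 0ℤ)
      cancel = solve-∀
    row₁ : x (fs fz) - + toℕ s ≡ h * m + (+ e * m′ + 0ℤ)
    row₁ = begin
      x (fs fz) - + toℕ s                         ≡⟨ shift (x (fs fz)) (m * h) (+ toℕ s) ⟩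
      (x (fs fz) - m * h) - + toℕ s + m * h       ≡⟨ cong (λ v → v - + toℕ s + m * h) x₁≡ ⟩
      (+ toℕ s + m′ * + e) - + toℕ s + m * h      ≡⟨ cancel (+ toℕ s) m′ (+ e) m h ⟩
      h * m + (+ e * m′ + 0ℤ)                     ∎
      where
      shift : ∀ v u s → v - s ≡ (v - u) - s + u
      shift = solve-∀
      cancel : ∀ s m′ e m h → (s + m′ * e) - s + m * h ≡ h * m + (e * m′ + 0ℤ)
      cancel = solve-∀

∣i∣≡±i : ∀ i → ∃ λ s → + ∣ i ∣ ≡ s * i
∣i∣≡±i i with ℤP.+∣i∣≡i⊎+∣i∣≡-i i
... | inj₁ ∣i∣≡i  = 1ℤ , trans ∣i∣≡i (sym (ℤP.*-identityˡ i))
... | inj₂ ∣i∣≡-i = - 1ℤ , trans ∣i∣≡-i (sym (-1*x≈-x i))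

pos-identity⇒difference : ∀ {d} m n X Y → d ℕ.+ Y ℕ.* n ≡ X ℕ.* m → + d ≡ + X * + m - + Y * + n
pos-identity⇒difference {d} m n X Y eq = begin
  + d                                 ≡⟨ add-sub (+ d) (+ Y * + n) ⟩
  + d + + Y * + n - + Y * + n         ≡⟨ cong (λ u → + d + u - + Y * + n) (ℤP.pos-* Y n) ⟨
  + (d ℕ.+ Y ℕ.* n) - + Y * + n       ≡⟨ cong (λ u → + u - + Y * + n) eq ⟩
  + (X ℕ.* m) - + Y * + n             ≡⟨ cong (λ u → u - + Y * + n) (ℤP.pos-* X m) ⟩
  + X * + m - + Y * + n               ∎
  where
  open ≡-Reasoning
  add-sub : ∀ u v → u ≡ u + v - v
  add-sub = solve-∀

bézout : ∀ a b → ∃₂ λ x y → ℤG.gcd a b ≡ x * a + y * b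
bézout a b with ∣i∣≡±i a | ∣i∣≡±i b | ℕG.Bézout.identity (ℕG.gcd-GCD ∣ a ∣ ∣ b ∣)
... | sa , ∣a∣≡ | sb , ∣b∣≡ | ℕG.Bézout.+- X Y eq =
  + X * sa , - (+ Y * sb) , trans (pos-identity⇒difference ∣ a ∣ ∣ b ∣ X Y eq) (signs ∣a∣≡ ∣b∣≡ (+ X) (+ Y))
  where
  signs : ∀ {u v} → u ≡ sa * a → v ≡ sb * b → ∀ X Y → X * u - Y * v ≡ X * sa * a + - (Y * sb) * b
  signs refl refl X Y = rearrange X Y sa sb a b
    where
    rearrange : ∀ X Y sa sb a b → X * (sa * a) - Y * (sb * b) ≡ X * sa * a + - (Y * sb) * b
    rearrange = solve-∀
... | sa , ∣a∣≡ | sb , ∣b∣≡ | ℕG.Bézout.-+ X Y eq =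
  - (+ X * sa) , + Y * sb , trans (pos-identity⇒difference ∣ b ∣ ∣ a ∣ Y X eq) (signs ∣a∣≡ ∣b∣≡ (+ X) (+ Y))
  where
  signs : ∀ {u v} → u ≡ sa * a → v ≡ sb * b → ∀ X Y → Y * v - X * u ≡ - (X * sa) * a + Y * sb * b
  signs refl refl X Y = rearrange X Y sa sb a b
    where
    rearrange : ∀ X Y sa sb a b → Y * (sb * b) - X * (sa * a) ≡ - (X * sa) * a + Y * sb * b
    rearrange = solve-∀

coprime-cofactors : ∀ {g a b a′ b′ x y} .{{_ : NonZero g}} →
  a ≡ a′ * + g → b ≡ b′ * + g → + g ≡ x * a + y * b → x * a′ + y * b′ ≡ 1ℤ
coprime-cofactors {g} {a} {b} {a′} {b′} {x} {y} a≡a′g b≡b′g g≡xa+yb = ℤP.*-cancelʳ-≡ _ _ (+ g) (begin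
  (x * a′ + y * b′) * + g            ≡⟨ expand x y a′ b′ (+ g) ⟩
  x * (a′ * + g) + y * (b′ * + g)    ≡⟨ cong₂ (λ u v → x * u + y * v) a≡a′g b≡b′g ⟨
  x * a + y * b                      ≡⟨ g≡xa+yb ⟨
  + g                                ≡⟨ ℤP.*-identityˡ (+ g) ⟨
  1ℤ * + g                           ∎)
  where
  open ≡-Reasoning
  expand : ∀ x y a′ b′ g → (x * a′ + y * b′) * g ≡ x * (a′ * g) + y * (b′ * g)
  expand = solve-∀

det₂ : Matℤ 2 → ℤ
det₂ B = B fz fz * B (fs fz) (fs fz) - B fz (fs fz) * B (fs fz) fz

factor-of-positive : ∀ g e {n} .{{_ : NonZero n}} → + g * e ≡ + n → ∃ λ E → e ≡ + E × g ℕ.* E ≡ n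
factor-of-positive g       (+ E)      ge≡n = E , refl , ℤP.+-injective (trans (ℤP.pos-* g E) ge≡n)
factor-of-positive zero    -[1+ _ ] {suc _} ()
factor-of-positive (suc _) -[1+ _ ] {suc _} ()

-- Right multiplication by the unimodular matrix [[x, −b′], [y, a′]] turns B into
-- lowerTriangular g (c x + d y) E, so both matrices span the same lattice.
module ColumnReduction (B : Matℤ 2) {g : ℕ} {a′ b′ x y : ℤ} {E : ℕ}
  (a≡a′g : B fz fz ≡ a′ * + g) (b≡b′g : B fz (fs fz) ≡ b′ * + g) (xa′+yb′≡1 : x * a′ + y * b′ ≡ 1ℤ)
  (e≡E : B (fs fz) (fs fz) * a′ - B (fs fz) fz * b′ ≡ + E) where

  c d h : ℤ
  c = B (fs fz) fz
  d = B (fs fz) (fs fz)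
  h = c * x + d * y

  L : Matℤ 2
  L = lowerTriangular g h E

  private
    ×xa′+yb′ : ∀ u → u ≡ u * (x * a′ + y * b′)
    ×xa′+yb′ u = trans (sym (ℤP.*-identityʳ u)) (cong (u *_) (sym xa′+yb′≡1))

    top : ∀ {u} u′ w → u ≡ u′ * + g → u ≡ + g * u′ + (0ℤ * w + 0ℤ)
    top u′ w u≡u′g = trans u≡u′g (shape u′ w (+ g))
      where
      shape : ∀ u′ w g → u′ * g ≡ g * u′ + (0ℤ * w + 0ℤ)
      shape = solve-∀

  B⊆L : ∀ j → col B j ∈ℒ L
  B⊆L fz = (a′ ∷ - y ∷ []) , λ
    { fz      → top a′ (- y) a≡a′g
    ; (fs fz) → trans (×xa′+yb′ c) (trans (split c d x y a′ b′) (cong (λ u → h * a′ + (u * - y + 0ℤ)) e≡E)) }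
    where
    split : ∀ c d x y a′ b′ → c * (x * a′ + y * b′) ≡ (c * x + d * y) * a′ + ((d * a′ - c * b′) * - y + 0ℤ)
    split = solve-∀
  B⊆L (fs fz) = (b′ ∷ x ∷ []) , λ
    { fz      → top b′ x b≡b′g
    ; (fs fz) → trans (×xa′+yb′ d) (trans (split c d x y a′ b′) (cong (λ u → h * b′ + (u * x + 0ℤ)) e≡E)) }
    where
    split : ∀ c d x y a′ b′ → d * (x * a′ + y * b′) ≡ (c * x + d * y) * b′ + ((d * a′ - c * b′) * x + 0ℤ)
    split = solve-∀

  L⊆B : ∀ j → col L j ∈ℒ B
  L⊆B fz = (x ∷ y ∷ []) , λ
    { fz      → trans (×xa′+yb′ (+ g))
                  (trans (split (+ g) x y a′ b′) (sym (cong₂ (λ u v → u * x + (v * y + 0ℤ)) a≡a′g b≡b′g)))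
    ; (fs fz) → cong (λ v → c * x + v) (sym (ℤP.+-identityʳ (d * y))) }
    where
    split : ∀ g x y a′ b′ → g * (x * a′ + y * b′) ≡ a′ * g * x + (b′ * g * y + 0ℤ)
    split = solve-∀
  L⊆B (fs fz) = (- b′ ∷ a′ ∷ []) , λ
    { fz      → trans (cancel a′ b′ (+ g)) (sym (cong₂ (λ u v → u * - b′ + (v * a′ + 0ℤ)) a≡a′g b≡b′g))
    ; (fs fz) → trans (sym e≡E) (shape c d a′ b′) }
    where
    cancel : ∀ a′ b′ g → 0ℤ ≡ a′ * g * - b′ + (b′ * g * a′ + 0ℤ)
    cancel = solve-∀
    shape : ∀ c d a′ b′ → d * a′ - c * b′ ≡ c * - b′ + (d * a′ + 0ℤ)
    shape = solve-∀

QuotientHasOrder-det₂ : ∀ (B : Matℤ 2) {n} {{_ : NonZero n}} → det₂ B ≡ + n → QuotientHasOrder 2 B n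
QuotientHasOrder-det₂ B {n} det≡n =
  subst (QuotientHasOrder 2 B) gE≡n (QuotientHasOrder-sameLattice {M = B} {L} B⊆L L⊆B
    (QuotientHasOrder-lowerTriangular g h E))
  where
  a = B fz fz
  b = B fz (fs fz)
  g = ℕG.gcd ∣ a ∣ ∣ b ∣
  g∣a : + g ∣ a
  g∣a = ∣ᵤ⇒∣ {+ g} {a} (ℤG.gcd[i,j]∣i a b)
  g∣b : + g ∣ b
  g∣b = ∣ᵤ⇒∣ {+ g} {b} (ℤG.gcd[i,j]∣j a b)
  a′ = quotient g∣a
  b′ = quotient g∣b
  e = B (fs fz) (fs fz) * a′ - B (fs fz) fz * b′

  det≡ge : det₂ B ≡ + g * e
  det≡ge = trans (cong₂ (λ u v → u * B (fs fz) (fs fz) - v * B (fs fz) fz) (_∣_.equality g∣a) (_∣_.equality g∣b))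
                 (factor a′ b′ (B (fs fz) fz) (B (fs fz) (fs fz)) (+ g))
    where
    factor : ∀ a′ b′ c d g → a′ * g * d - b′ * g * c ≡ g * (d * a′ - c * b′)
    factor = solve-∀

  positive = factor-of-positive g e (trans (sym det≡ge) det≡n)
  E = proj₁ positive
  gE≡n : g ℕ.* E ≡ n
  gE≡n = proj₂ (proj₂ positive)

  instance
    gE≢0 : NonZero (g ℕ.* E)
    gE≢0 = subst NonZero (sym gE≡n) it
    g≢0 : NonZero g
    g≢0 = ℕP.m*n≢0⇒m≢0 g
    E≢0 : NonZero E
    E≢0 = ℕP.m*n≢0⇒n≢0 g

  x = proj₁ (bézout a b)
  y = proj₁ (proj₂ (bézout a b))

  xa′+yb′≡1 : x * a′ + y * b′ ≡ 1ℤ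
  xa′+yb′≡1 = coprime-cofactors {g} {a} {b} {a′} {b′} {x} {y}
                (_∣_.equality g∣a) (_∣_.equality g∣b) (proj₂ (proj₂ (bézout a b)))

  open ColumnReduction B {g} {a′} {b′} {x} {y} {E}
    (_∣_.equality g∣a) (_∣_.equality g∣b) xa′+yb′≡1 (proj₁ (proj₂ positive))

if-δ : ∀ (u v w : ℤ) {a b c d e f} → (a ≡ b → ¬ c ≡ d) → (a ≡ b → ¬ e ≡ f) → (c ≡ d → ¬ e ≡ f) →
  (if ⌊ a ℕ.≟ b ⌋ then u else if ⌊ c ℕ.≟ d ⌋ then v else if ⌊ e ℕ.≟ f ⌋ then w else 0ℤ)
  ≡ u * δ a b + v * δ c d + w * δ e f
if-δ u v w {a} {b} {c} {d} {e} {f} ab⇏cd ab⇏ef cd⇏ef with a ℕ.≟ b | c ℕ.≟ d | e ℕ.≟ f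
... | yes ab | yes cd | _      = ⊥-elim (ab⇏cd ab cd)
... | yes ab | no _   | yes ef = ⊥-elim (ab⇏ef ab ef)
... | no _   | yes cd | yes ef = ⊥-elim (cd⇏ef cd ef)
... | yes ab | no ¬cd | no ¬ef rewrite δ-≡ ab | δ-≢ ¬cd | δ-≢ ¬ef = select u v w
  where
  select : ∀ u v w → u ≡ u * 1ℤ + v * 0ℤ + w * 0ℤ
  select = solve-∀
... | no ¬ab | yes cd | no ¬ef rewrite δ-≢ ¬ab | δ-≡ cd | δ-≢ ¬ef = select u v w
  where
  select : ∀ u v w → v ≡ u * 0ℤ + v * 1ℤ + w * 0ℤ
  select = solve-∀
... | no ¬ab | no ¬cd | yes ef rewrite δ-≢ ¬ab | δ-≢ ¬cd | δ-≡ ef = select u v w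
  where
  select : ∀ u v w → w ≡ u * 0ℤ + v * 0ℤ + w * 1ℤ
  select = solve-∀
... | no ¬ab | no ¬cd | no ¬ef rewrite δ-≢ ¬ab | δ-≢ ¬cd | δ-≢ ¬ef = select u v w
  where
  select : ∀ u v w → 0ℤ ≡ u * 0ℤ + v * 0ℤ + w * 0ℤ
  select = solve-∀

module Cycle (m : ℕ) where

  K : ℕ
  K = suc (suc (suc m))

  next : ℕ → ℕ
  next n = suc n % K

  prev : ℕ → ℕ
  prev zero    = suc (suc m)
  prev (suc n) = n

  prev< : ∀ {n} → n < K → prev n < K
  prev< {zero}  _   = ℕP.n<1+n (suc (suc m))
  prev< {suc n} n<K = ℕP.<-trans (ℕP.n<1+n n) n<K

  next-cases : ∀ {n} → n < K → (suc n < K × next n ≡ suc n) ⊎ (n ≡ suc (suc m) × next n ≡ 0)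
  next-cases {n} n<K with ℕP.m≤n⇒m<n∨m≡n n<K
  ... | inj₁ 1+n<K = inj₁ (1+n<K , ℕD.m<n⇒m%n≡m 1+n<K)
  ... | inj₂ 1+n≡K = inj₂ (ℕP.suc-injective 1+n≡K , trans (cong (_% K) 1+n≡K) (ℕD.n%n≡0 K))

  prev-next : ∀ {n} → n < K → prev (next n) ≡ n
  prev-next n<K with next-cases n<K
  ... | inj₁ (_ , next≡) = cong prev next≡
  ... | inj₂ (n≡ , next≡) = trans (cong prev next≡) (sym n≡)

  next-prev : ∀ {n} → n < K → next (prev n) ≡ n
  next-prev {zero}  _   = ℕD.n%n≡0 K
  next-prev {suc n} n<K = ℕD.m<n⇒m%n≡m n<K

  next≢ : ∀ {n} → n < K → next n ≢ n
  next≢ n<K with next-cases n<K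
  ... | inj₁ (_ , next≡)  = ℕP.1+n≢n ∘ trans (sym next≡)
  ... | inj₂ (n≡ , next≡) = λ next≡n → ℕP.0≢1+n (trans (sym next≡) (trans next≡n n≡))

  next²≢ : ∀ {n} → n < K → next (next n) ≢ n
  next²≢ {n} n<K next²≡n with next-cases n<K
  ... | inj₂ (n≡ , next≡) = ℕP.0≢1+n (ℕP.suc-injective (trans (sym (cong next next≡)) (trans next²≡n n≡)))
  ... | inj₁ (1+n<K , next≡) with next-cases 1+n<K
  ...   | inj₁ (_ , next′≡) = ℕP.m≢1+n+m n {1} (sym (trans (sym (trans (cong next next≡) next′≡)) next²≡n))
  ...   | inj₂ (1+n≡ , next′≡) =
    ℕP.0≢1+n (trans (sym (trans (cong next next≡) next′≡)) (trans next²≡n (ℕP.suc-injective 1+n≡)))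

recurrence : (p q u₀ u₁ : ℤ) → ℕ → ℤ
recurrence p q u₀ u₁ zero          = u₀
recurrence p q u₀ u₁ (suc zero)    = u₁
recurrence p q u₀ u₁ (suc (suc n)) = p * recurrence p q u₀ u₁ (suc n) - q * recurrence p q u₀ u₁ n

recurrence-1,0 : ∀ p q n → recurrence p q 1ℤ 0ℤ (suc n) ≡ - q * recurrence p q 0ℤ 1ℤ n
recurrence-1,0 p q zero          = step₀ q
  where
  step₀ : ∀ q → 0ℤ ≡ - q * 0ℤ
  step₀ = solve-∀
recurrence-1,0 p q (suc zero)    = step₁ p q
  where
  step₁ : ∀ p q → p * 0ℤ - q * 1ℤ ≡ - q * 1ℤ
  step₁ = solve-∀
recurrence-1,0 p q (suc (suc n)) =
  trans (cong₂ (λ u v → p * u - q * v) (recurrence-1,0 p q (suc n)) (recurrence-1,0 p q n))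
        (step p q (recurrence p q 0ℤ 1ℤ n) (recurrence p q 0ℤ 1ℤ (suc n)))
  where
  step : ∀ p q w₀ w₁ → p * (- q * w₁) - q * (- q * w₀) ≡ - q * (p * w₁ - q * w₀)
  step = solve-∀

cassini : ∀ p q n → let W = recurrence p q 0ℤ 1ℤ in W (suc n) * W (suc n) - W n * W (suc (suc n)) ≡ q ^ℤ n
cassini p q zero    = base p q
  where
  base : ∀ p q → 1ℤ * 1ℤ - 0ℤ * (p * 1ℤ - q * 0ℤ) ≡ 1ℤ
  base = solve-∀
cassini p q (suc n) =
  trans (step p q (recurrence p q 0ℤ 1ℤ n) (recurrence p q 0ℤ 1ℤ (suc n))) (cong (q *_) (cassini p q n))
  where
  step : ∀ p q w₀ w₁ → (p * w₁ - q * w₀) * (p * w₁ - q * w₀) - w₁ * (p * (p * w₁ - q * w₀) - q * w₁)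
                      ≡ q * (w₁ * w₁ - w₀ * (p * w₁ - q * w₀))
  step = solve-∀

lucas : ∀ p q n → let W = recurrence p q 0ℤ 1ℤ in recurrence p q (+ 2) p (suc n) ≡ W (suc (suc n)) - q * W n
lucas p q zero          = base₁ p q
  where
  base₁ : ∀ p q → p ≡ p * 1ℤ - q * 0ℤ - q * 0ℤ
  base₁ = solve-∀
lucas p q (suc zero)    = base₂ p q
  where
  base₂ : ∀ p q → p * p - q * + 2 ≡ p * (p * 1ℤ - q * 0ℤ) - q * 1ℤ - q * 1ℤ
  base₂ = solve-∀
lucas p q (suc (suc n)) =
  trans (cong₂ (λ u v → p * u - q * v) (lucas p q (suc n)) (lucas p q n))
        (step p q (recurrence p q 0ℤ 1ℤ n) (recurrence p q 0ℤ 1ℤ (suc n)))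
  where
  step : ∀ p q w₀ w₁ → p * ((p * (p * w₁ - q * w₀) - q * w₁) - q * w₁) - q * ((p * w₁ - q * w₀) - q * w₀)
                      ≡ (p * (p * (p * w₁ - q * w₀) - q * w₁) - q * (p * w₁ - q * w₀)) - q * (p * w₁ - q * w₀)
  step = solve-∀

powerSum≡recurrence : ∀ n q x → powerSum n q x ≡ recurrence (+ 1 + q - x) q (+ 2) (+ 1 + q - x) n
powerSum≡recurrence zero          q x = refl
powerSum≡recurrence (suc zero)    q x = refl
powerSum≡recurrence (suc (suc n)) q x =
  cong₂ (λ u v → (+ 1 + q - x) * u - q * v) (powerSum≡recurrence (suc n) q x) (powerSum≡recurrence n q x)

pos-1+q+t : ∀ q t → + (1 ℕ.+ q ℕ.+ t) ≡ + 1 + + q + + t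
pos-1+q+t q t = trans (ℤP.pos-+ (1 ℕ.+ q) t) (cong (_+ + t) (ℤP.pos-+ 1 q))

pos-^ℤ : ∀ q n → (+ q) ^ℤ n ≡ + (q ℕ.^ n)
pos-^ℤ q zero    = refl
pos-^ℤ q (suc n) = trans (cong (+ q *_) (pos-^ℤ q n)) (sym (ℤP.pos-* q (q ℕ.^ n)))

module _ (q t : ℕ) where

  minusN : ℕ → ℤ
  minusN n = powerSum n (+ q) (- + t) - (+ q) ^ℤ n - 1ℤ

  -Npoly≡minusN : ∀ n → - Npoly n (+ q) (- + t) ≡ minusN n
  -Npoly≡minusN n = negate ((+ q) ^ℤ n) (powerSum n (+ q) (- + t))
    where
    negate : ∀ e p → - (1ℤ + e - p) ≡ p - e - 1ℤ
    negate = solve-∀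

  minusN-step : ∀ n → minusN (suc (suc n)) - minusN (suc n)
                      ≡ + q * (minusN (suc n) - minusN n) + + t * minusN (suc n) + + t * ((+ q) ^ℤ suc n + 1ℤ)
  minusN-step n = step (+ q) (+ t) (powerSum n (+ q) (- + t)) (powerSum (suc n) (+ q) (- + t)) ((+ q) ^ℤ n)
    where
    step : ∀ q t p₀ p₁ e → ((+ 1 + q - - t) * p₁ - q * p₀ - q * (q * e) - 1ℤ) - (p₁ - q * e - 1ℤ)
                           ≡ q * ((p₁ - q * e - 1ℤ) - (p₀ - e - 1ℤ)) + t * (p₁ - q * e - 1ℤ) + t * (q * e + 1ℤ)
    step = solve-∀

  minusN-increasing : 1 ≤ t → ∀ n → ∃₂ λ a b → minusN (suc n) ≡ + suc a × minusN (suc n) - minusN n ≡ + b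
  minusN-increasing (s≤s {n = t′} z≤n) zero = t′ , t , base (+ q) (+ t) , base′ (+ q) (+ t)
    where
    base : ∀ q t → (+ 1 + q - - t) - q * 1ℤ - 1ℤ ≡ t
    base = solve-∀
    base′ : ∀ q t → ((+ 1 + q - - t) - q * 1ℤ - 1ℤ) - (+ 2 - 1ℤ - 1ℤ) ≡ t
    base′ = solve-∀
  minusN-increasing 1≤t (suc n) with minusN-increasing 1≤t n
  ... | a , b , minusN≡ , increment≡ = a ℕ.+ c , c , minusN′≡ , increment′≡
    where
    open ≡-Reasoning
    Q = q ℕ.^ suc n
    c = q ℕ.* b ℕ.+ t ℕ.* suc a ℕ.+ t ℕ.* (Q ℕ.+ 1)
    increment′≡ : minusN (suc (suc n)) - minusN (suc n) ≡ + c
    increment′≡ = begin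
      minusN (suc (suc n)) - minusN (suc n)
        ≡⟨ minusN-step n ⟩
      + q * (minusN (suc n) - minusN n) + + t * minusN (suc n) + + t * ((+ q) ^ℤ suc n + 1ℤ)
        ≡⟨ cong₂ (λ u v → + q * u + + t * v + + t * ((+ q) ^ℤ suc n + 1ℤ)) increment≡ minusN≡ ⟩
      + q * + b + + t * + suc a + + t * ((+ q) ^ℤ suc n + 1ℤ)
        ≡⟨ cong (λ w → + q * + b + + t * + suc a + + t * (w + 1ℤ)) (pos-^ℤ q (suc n)) ⟩
      + q * + b + + t * + suc a + + t * (+ Q + 1ℤ)
        ≡⟨ cong₂ _+_ (cong₂ _+_ (ℤP.pos-* q b) (ℤP.pos-* t (suc a)))
                     (trans (ℤP.pos-* t (Q ℕ.+ 1)) (cong (+ t *_) (ℤP.pos-+ Q 1))) ⟨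
      + (q ℕ.* b) + + (t ℕ.* suc a) + + (t ℕ.* (Q ℕ.+ 1))
        ≡⟨ trans (cong (_+ + (t ℕ.* (Q ℕ.+ 1))) (ℤP.pos-+ (q ℕ.* b) (t ℕ.* suc a)))
                 (ℤP.pos-+ _ (t ℕ.* (Q ℕ.+ 1))) ⟨
      + c ∎
    minusN′≡ : minusN (suc (suc n)) ≡ + suc (a ℕ.+ c)
    minusN′≡ = begin
      minusN (suc (suc n))                                       ≡⟨ telescope (minusN (suc n)) (minusN (suc (suc n))) ⟩
      minusN (suc n) + (minusN (suc (suc n)) - minusN (suc n))   ≡⟨ cong₂ _+_ minusN≡ increment′≡ ⟩
      + suc a + + c                                              ≡⟨ ℤP.pos-+ (suc a) c ⟨
      + suc (a ℕ.+ c)                                            ∎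
      where
      telescope : ∀ x y → y ≡ x + (y - x)
      telescope = solve-∀

-- F sends e_n to V n = (U_n, W_n) and G
-- sends the standard basis of ℤ² to e₀, e₁; F kills the relations of the middle columns and maps
-- the two that wrap around the rim (j = 0 and j = K − 1) to the columns of Bm.
module Wheel (q t m : ℕ) where

  open Cycle m

  M : Matℤ K
  M = reducedLaplacian K q t

  s : ℤ
  s = + (1 ℕ.+ q ℕ.+ t)

  relation : ∀ {l} → (ℕ → Vecℤ l) → ℕ → Vecℤ l
  relation e n = s *ᵥ e n -ᵥ (+ q) *ᵥ e (prev n) -ᵥ e (next n)

  column : ∀ j → col M j ≗ relation basis (toℕ j)
  column j i = begin
    M i j
      ≡⟨ if-δ s (- + q) (- 1ℤ) i≡j⇏j≡i⁺ i≡j⇏i≡j⁺ j≡i⁺⇏i≡j⁺ ⟩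
    s * δ (toℕ i) (toℕ j) + - + q * δ (toℕ j) (next (toℕ i)) + - 1ℤ * δ (toℕ i) (next (toℕ j))
      ≡⟨ cong (λ d → s * δ (toℕ i) (toℕ j) + - + q * d + - 1ℤ * δ (toℕ i) (next (toℕ j)))
              (δ-cong j≡i⁺⇒i≡j⁻ i≡j⁻⇒j≡i⁺) ⟩
    s * δ (toℕ i) (toℕ j) + - + q * δ (toℕ i) (prev (toℕ j)) + - 1ℤ * δ (toℕ i) (next (toℕ j))
      ≡⟨ signs s (+ q) (δ (toℕ i) (toℕ j)) (δ (toℕ i) (prev (toℕ j))) (δ (toℕ i) (next (toℕ j))) ⟩
    relation basis (toℕ j) i ∎
    where
    open ≡-Reasoning
    i<K = FP.toℕ<n i
    j<K = FP.toℕ<n j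
    i≡j⇏j≡i⁺ : toℕ i ≡ toℕ j → toℕ j ≢ next (toℕ i)
    i≡j⇏j≡i⁺ i≡j j≡i⁺ = next≢ i<K (trans (sym j≡i⁺) (sym i≡j))
    i≡j⇏i≡j⁺ : toℕ i ≡ toℕ j → toℕ i ≢ next (toℕ j)
    i≡j⇏i≡j⁺ i≡j i≡j⁺ = next≢ i<K (trans (cong next i≡j) (sym i≡j⁺))
    j≡i⁺⇏i≡j⁺ : toℕ j ≡ next (toℕ i) → toℕ i ≢ next (toℕ j)
    j≡i⁺⇏i≡j⁺ j≡i⁺ i≡j⁺ = next²≢ i<K (trans (cong next (sym j≡i⁺)) (sym i≡j⁺))
    j≡i⁺⇒i≡j⁻ : toℕ j ≡ next (toℕ i) → toℕ i ≡ prev (toℕ j)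
    j≡i⁺⇒i≡j⁻ j≡i⁺ = trans (sym (prev-next i<K)) (cong prev (sym j≡i⁺))
    i≡j⁻⇒j≡i⁺ : toℕ i ≡ prev (toℕ j) → toℕ j ≡ next (toℕ i)
    i≡j⁻⇒j≡i⁺ i≡j⁻ = trans (sym (next-prev j<K)) (cong next (sym i≡j⁻))
    signs : ∀ s q a b c → s * a + - q * b + - 1ℤ * c ≡ s * a - q * b - c
    signs = solve-∀

  V : ℕ → Vecℤ 2
  V n c = recurrence s (+ q) (basis 0 c) (basis 1 c) n

  F : Mat 2 K
  F c i = V (toℕ i) c

  G : Mat K 2
  G i c = δ (toℕ i) (toℕ c)

  F⊙basis : ∀ {n} → n < K → F ⊙ basis n ≗ V n
  F⊙basis n<K c = trans (⊙-basis′ F n<K c) (cong (λ n → V n c) (FP.toℕ-fromℕ< n<K))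

  F⊙relation : ∀ {n} → n < K → F ⊙ relation basis n ≗ relation V n
  F⊙relation {n} n<K c = begin
    (F ⊙ relation basis n) c
      ≡⟨ ⊙--ᵥ F (s *ᵥ e₀ -ᵥ (+ q) *ᵥ e₋) e₊ c ⟩
    (F ⊙ (s *ᵥ e₀ -ᵥ (+ q) *ᵥ e₋)) c - (F ⊙ e₊) c
      ≡⟨ cong (λ u → u - (F ⊙ e₊) c) (⊙-lin₂ F s (+ q) e₀ e₋ c) ⟩
    s * (F ⊙ e₀) c - + q * (F ⊙ e₋) c - (F ⊙ e₊) c
      ≡⟨ cong₂ (λ u v → s * u - + q * v - (F ⊙ e₊) c) (F⊙basis n<K c) (F⊙basis (prev< n<K) c) ⟩
    s * V n c - + q * V (prev n) c - (F ⊙ e₊) c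
      ≡⟨ cong (λ u → s * V n c - + q * V (prev n) c - u) (F⊙basis (ℕD.m%n<n (suc n) K) c) ⟩
    relation V n c
      ∎
    where
    open ≡-Reasoning
    e₀ e₋ e₊ : Vecℤ K
    e₀ = basis n
    e₋ = basis (prev n)
    e₊ = basis (next n)

  Bm : Matℤ 2
  Bm c fz      = s * V 0 c - + q * V (suc (suc m)) c - V 1 c
  Bm c (fs fz) = s * V (suc (suc m)) c - + q * V (suc m) c - V 0 c

  relation-V∈ℒ : ∀ {n} → n < K → relation V n ∈ℒ Bm
  relation-V∈ℒ {zero}  _ = col∈ℒ Bm fz
  relation-V∈ℒ {suc n} 1+n<K with ℕP.m≤n⇒m<n∨m≡n 1+n<K
  ... | inj₁ 2+n<K = ∈ℒ-resp {M = Bm} vanishes (0∈ℒ {M = Bm})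
    where
    vanishes : (λ _ → 0ℤ) ≗ relation V (suc n)
    vanishes c = sym (trans (cong (λ u → s * V (suc n) c - + q * V n c - V u c) (ℕD.m<n⇒m%n≡m 2+n<K))
                            (ℤP.+-inverseʳ (s * V (suc n) c - + q * V n c)))
  ... | inj₂ refl  = ∈ℒ-resp {M = Bm} wraps (col∈ℒ Bm (fs fz))
    where
    wraps : col Bm (fs fz) ≗ relation V (suc (suc m))
    wraps c = cong (λ u → s * V (suc (suc m)) c - + q * V (suc m) c - V u c) (sym (ℕD.n%n≡0 K))

  F∈ℒ : ∀ j → F ⊙ col M j ∈ℒ Bm
  F∈ℒ j = ∈ℒ-resp {M = Bm} (λ c → sym (trans (⊙-cong F (column j) c) (F⊙relation (FP.toℕ<n j) c)))
                  (relation-V∈ℒ (FP.toℕ<n j))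

  recurrence-step : ∀ {n} → suc (suc n) < K →
                    s *ᵥ basis (suc n) -ᵥ (+ q) *ᵥ basis n ≈[ M ] basis (suc (suc n))
  recurrence-step {n} 2+n<K = ∈ℒ⇒≈ {M = M} {s *ᵥ basis (suc n) -ᵥ (+ q) *ᵥ basis n} {basis (suc (suc n))}
    (∈ℒ-resp {M = M} col≗ (col∈ℒ M j))
    where
    1+n<K = ℕP.<-trans (ℕP.n<1+n (suc n)) 2+n<K
    j = fromℕ< 1+n<K
    col≗ : col M j ≗ s *ᵥ basis (suc n) -ᵥ (+ q) *ᵥ basis n -ᵥ basis (suc (suc n))
    col≗ i = trans (subst (λ l → M i j ≡ relation basis l i) (FP.toℕ-fromℕ< 1+n<K) (column j i))
                   (cong (λ l → s * δ (toℕ i) (suc n) - + q * δ (toℕ i) n - δ (toℕ i) l) (ℕD.m<n⇒m%n≡m 2+n<K))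

  basis≈G⊙V : ∀ {n} → n < K → basis n ≈[ M ] G ⊙ V n
  basis≈G⊙V {zero}        _     = ≗⇒≈ {M = M} (λ i → sym (⊙-basis G fz i))
  basis≈G⊙V {suc zero}    _     = ≗⇒≈ {M = M} (λ i → sym (⊙-basis G (fs fz) i))
  basis≈G⊙V {suc (suc n)} 2+n<K = begin
    basis (suc (suc n))
      ≈⟨ recurrence-step 2+n<K ⟨
    s *ᵥ basis (suc n) -ᵥ (+ q) *ᵥ basis n
      ≈⟨ ≈-lin₂ {M = M} s (+ q) {basis (suc n)} {G ⊙ V (suc n)} {basis n} {G ⊙ V n}
                (basis≈G⊙V 1+n<K) (basis≈G⊙V n<K) ⟩
    s *ᵥ G ⊙ V (suc n) -ᵥ (+ q) *ᵥ G ⊙ V n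
      ≈⟨ ≗⇒≈ {M = M} (λ i → sym (⊙-lin₂ G s (+ q) (V (suc n)) (V n) i)) ⟩
    G ⊙ V (suc (suc n))
      ∎
    where
    open ≈-Reasoning M
    1+n<K = ℕP.<-trans (ℕP.n<1+n (suc n)) 2+n<K
    n<K = ℕP.<-trans (ℕP.n<1+n n) 1+n<K

  G⊙F≈id : ∀ j → basis (toℕ j) ≈[ M ] G ⊙ col F j
  G⊙F≈id j = basis≈G⊙V (FP.toℕ<n j)

  Bm-columns : ∀ d → ∃ λ j → col Bm d ≗ F ⊙ col M j
  Bm-columns fz      = fz , λ c → sym (trans (⊙-cong F (column fz) c) (F⊙relation (FP.toℕ<n fz) c))
  Bm-columns (fs fz) = last , λ c → sym (trans (⊙-cong F (column last) c)
    (subst (λ l → (F ⊙ relation basis l) c ≡ Bm c (fs fz)) (sym (FP.toℕ-fromℕ< K-1<K))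
           (trans (F⊙relation K-1<K c)
                  (cong (λ u → s * V (suc (suc m)) c - + q * V (suc m) c - V u c) (ℕD.n%n≡0 K)))))
    where
    K-1<K = ℕP.n<1+n (suc (suc m))
    last = fromℕ< K-1<K

  G∈ℒ : ∀ d → G ⊙ col Bm d ∈ℒ M
  G∈ℒ d with Bm-columns d
  ... | j , col≗ = ∈ℒ-resp {M = M} (λ i → sym (⊙-cong G col≗ i))
                     (∈ℒ-≈ {M = M} (col∈ℒ M j) (basis-≈⇒≈ {M = M} F G G⊙F≈id (col M j)))

  F⊙G≈id : ∀ d → basis (toℕ d) ≈[ Bm ] F ⊙ col G d
  F⊙G≈id fz      = ≗⇒≈ {M = Bm} (λ c → sym (⊙-basis F fz c))
  F⊙G≈id (fs fz) = ≗⇒≈ {M = Bm} (λ c → sym (⊙-basis F (fs fz) c))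

  QuotientHasOrder-Bm⇒M : ∀ {n} → QuotientHasOrder 2 Bm n → QuotientHasOrder K M n
  QuotientHasOrder-Bm⇒M = QuotientHasOrder-retract {M = M} {Bm} F G F∈ℒ G∈ℒ G⊙F≈id F⊙G≈id

  powerSum≡recurrence-s : ∀ n → powerSum n (+ q) (- + t) ≡ recurrence s (+ q) (+ 2) s n
  powerSum≡recurrence-s n =
    trans (powerSum≡recurrence n (+ q) (- + t)) (cong (λ p → recurrence p (+ q) (+ 2) p n) s′≡s)
    where
    negneg : ∀ q t → + 1 + q - - t ≡ + 1 + q + t
    negneg = solve-∀
    s′≡s : + 1 + + q - - + t ≡ s
    s′≡s = trans (negneg (+ q) (+ t)) (sym (pos-1+q+t q t))

  det₂Bm : det₂ Bm ≡ - Npoly K (+ q) (- + t)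
  det₂Bm = begin
    (s * 1ℤ - + q * U (suc (suc m)) - 0ℤ) * (s * W (suc (suc m)) - + q * W (suc m) - 0ℤ)
      - (s * U (suc (suc m)) - + q * U (suc m) - 1ℤ) * (s * 0ℤ - + q * W (suc (suc m)) - 1ℤ)
        ≡⟨ cong₂ (λ u v → (s * 1ℤ - + q * u - 0ℤ) * (s * W (suc (suc m)) - + q * W (suc m) - 0ℤ)
                          - (s * u - + q * v - 1ℤ) * (s * 0ℤ - + q * W (suc (suc m)) - 1ℤ))
                 (recurrence-1,0 s (+ q) (suc m)) (recurrence-1,0 s (+ q) m) ⟩
    (s * 1ℤ - + q * (- + q * W (suc m)) - 0ℤ) * (s * W (suc (suc m)) - + q * W (suc m) - 0ℤ)
      - (s * (- + q * W (suc m)) - + q * (- + q * W m) - 1ℤ) * (s * 0ℤ - + q * W (suc (suc m)) - 1ℤ)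
        ≡⟨ expand s (+ q) (W m) (W (suc m)) ⟩
    - (1ℤ + + q * (+ q * (+ q * (W (suc m) * W (suc m) - W m * W (suc (suc m)))))
          - (W (suc (suc (suc (suc m)))) - + q * W (suc (suc m))))
        ≡⟨ cong₂ (λ u v → - (1ℤ + + q * (+ q * (+ q * u)) - v))
                 (cassini s (+ q) m) (sym (lucas s (+ q) (suc (suc m)))) ⟩
    - (1ℤ + (+ q) ^ℤ K - recurrence s (+ q) (+ 2) s K)
        ≡⟨ cong (λ u → - (1ℤ + (+ q) ^ℤ K - u)) (powerSum≡recurrence-s K) ⟨
    - Npoly K (+ q) (- + t)   ∎
    where
    open ≡-Reasoning
    U W : ℕ → ℤ
    U = recurrence s (+ q) 1ℤ 0ℤ
    W = recurrence s (+ q) 0ℤ 1ℤ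
    expand : ∀ s q w₀ w₁ →
      (s * 1ℤ - q * (- q * w₁) - 0ℤ) * (s * (s * w₁ - q * w₀) - q * w₁ - 0ℤ)
        - (s * (- q * w₁) - q * (- q * w₀) - 1ℤ) * (s * 0ℤ - q * (s * w₁ - q * w₀) - 1ℤ)
      ≡ - (1ℤ + q * (q * (q * (w₁ * w₁ - w₀ * (s * w₁ - q * w₀))))
            - ((s * (s * (s * w₁ - q * w₀) - q * w₁) - q * (s * w₁ - q * w₀)) - q * (s * w₁ - q * w₀)))
    expand = solve-∀

  criticalGroupOrder : 1 ≤ t → ∃ λ n → QuotientHasOrder K M n × + n ≡ - Npoly K (+ q) (- + t)
  criticalGroupOrder 1≤t with minusN-increasing q t 1≤t (suc (suc m))
  ... | a , _ , minusN≡ , _ =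
    suc a , QuotientHasOrder-Bm⇒M (QuotientHasOrder-det₂ Bm (trans det₂Bm -N≡)) , sym -N≡
    where
    -N≡ : - Npoly K (+ q) (- + t) ≡ + suc a
    -N≡ = trans (-Npoly≡minusN q t K) minusN≡

criticalGroupOrder₁ : ∀ q t → 1 ≤ t →
  ∃ λ n → QuotientHasOrder 1 (reducedLaplacian 1 q t) n × + n ≡ - Npoly 1 (+ q) (- + t)
criticalGroupOrder₁ q (suc t′) _ = suc t′ , QuotientHasOrder-1×1 (suc t′) , spoke (+ q) (+ suc t′)
  where
  spoke : ∀ q t → t ≡ - (1ℤ + q * 1ℤ - (+ 1 + q - - t))
  spoke = solve-∀

criticalGroupOrder₂ : ∀ q t → 1 ≤ t →
  ∃ λ n → QuotientHasOrder 2 (reducedLaplacian 2 q t) n × + n ≡ - Npoly 2 (+ q) (- + t)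
criticalGroupOrder₂ q t@(suc _) _ = n , QuotientHasOrder-det₂ (reducedLaplacian 2 q t) det≡n , sym -N≡n
  where
  open ≡-Reasoning
  n = t ℕ.* (2 ℕ.+ q ℕ.+ q ℕ.+ t)
  n≡ : + n ≡ + t * (+ 2 + + q + + q + + t)
  n≡ = trans (ℤP.pos-* t _) (cong (+ t *_) (trans (ℤP.pos-+ (2 ℕ.+ q ℕ.+ q) t)
         (cong (_+ + t) (trans (ℤP.pos-+ (2 ℕ.+ q) q) (cong (_+ + q) (ℤP.pos-+ 2 q))))))
  det≡n : det₂ (reducedLaplacian 2 q t) ≡ + n
  det≡n = begin
    + (1 ℕ.+ q ℕ.+ t) * + (1 ℕ.+ q ℕ.+ t) - - + (1 ℕ.+ q) * - + (1 ℕ.+ q)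
      ≡⟨ cong₂ (λ u v → u * u - - v * - v) (pos-1+q+t q t) (ℤP.pos-+ 1 q) ⟩
    (+ 1 + + q + + t) * (+ 1 + + q + + t) - - (+ 1 + + q) * - (+ 1 + + q)
      ≡⟨ expand (+ q) (+ t) ⟩
    + t * (+ 2 + + q + + q + + t)
      ≡⟨ n≡ ⟨
    + n ∎
    where
    expand : ∀ q t → (+ 1 + q + t) * (+ 1 + q + t) - - (+ 1 + q) * - (+ 1 + q) ≡ t * (+ 2 + q + q + t)
    expand = solve-∀
  -N≡n : - Npoly 2 (+ q) (- + t) ≡ + n
  -N≡n = trans (expand (+ q) (+ t)) (sym n≡)
    where
    expand : ∀ q t → - (1ℤ + q * (q * 1ℤ) - ((+ 1 + q - - t) * (+ 1 + q - - t) - q * + 2)) ≡ t * (+ 2 + q + q + t)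
    expand = solve-∀

theorem4 : (q t k : ℕ) → 1 ≤ t → 1 ≤ k →
    Σ ℕ λ n → QuotientHasOrder k (reducedLaplacian k q t) n
    × (+ n ≡ - Npoly k (+ q) (- (+ t)))
theorem4 q t 1                   1≤t _ = criticalGroupOrder₁ q t 1≤t
theorem4 q t 2                   1≤t _ = criticalGroupOrder₂ q t 1≤t
theorem4 q t (suc (suc (suc m))) 1≤t _ = Wheel.criticalGroupOrder q t m 1≤t
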